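{- Let $k\ge3$ be an odd integer and let $A$ be a $k$-diagonal array of size $n>k$ with width $s$, written in standard form. If $\gcd(n,s+1)=1$, then $R=(1,\dots,1)$ and $C=(-1,1,\dots,1)$ are a solution of $P(A)$.
   Context: Arrays are toroidal: an $n\times n$ array has rows and columns indexed modulo $n$ (representatives $1,\dots,n$). Each cell is filled or empty; $F(A)$ is the set of filled cells. For $(i,j)\in F(A)$: - the row successor $s_r((i,j))$ is $(i,j+k)$ with $k\ge1$ minimal such that $(i,j+k)\in F(A)$; - the column successor $s_c((i,j))$ is $(i+k,j)$ with $k\ge1$ minimal such that $(i+k,j)\in F(A)$. Given $R,C\in\{ -1,1\}^n$, the move function is $S_{R,C}((i,j))=s_c^{\,c_{j'}}((i,j'))$, where $(i,j')=s_r^{\,r_i}((i,j))$; exponent $-1$ means inverse. $R,C$ is a solution of $P(A)$ if $S_{R,C}$ is a single cycle on $F(A)$. Diagonals: $D_i=\{(i+t-1,t): t=1,\dots,n\}$, with row indices modulo $n$. A square array of size $n\ge k$ is $k$-diagonal if its filled cells are exactly the cells of $k$ distinct diagonals. Empty strips and width: an empty strip of width $t$ is a set $\{D_{r+1},\dots,D_{r+t}\}$ of empty diagonals such that $D_r$ and $D_{r+t+1}$ are filled (indices modulo $n$). A $k$-diagonal array has width $s$ if all its empty strips have width $s$. Standard form: the array is in standard form if $D_1$ is filled and $D_n$ is empty. -}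

module Defs where

open import Data.Nat using (ℕ; zero; suc; _+_; _∸_; _≤_; _%_; NonZero)
open import Data.Nat.DivMod using (m%n<n)
open import Data.Fin using (Fin; toℕ; fromℕ<) renaming (zero to fzero; suc to fsuc)
open import Data.Fin.Subset using (Subset; _∈_; ∣_∣)
open import Data.Bool using (Bool; true; false; if_then_else_)
open import Data.Sign using (Sign) renaming (+ to plus; - to minus)
open import Data.Product using (Σ; ∃; _×_; _,_; proj₁; proj₂)
open import Function using (_⇔_)
open import Relation.Binary.PropositionalEquality using (_≡_)

-- An n×n toroidal array: A r c = true iff cell (r,c) is filled.
-- Fin n position p represents the paper's index p+1 (representatives 1..n).
Array : ℕ → Set
Array n = Fin n → Fin n → Bool

Cell : ℕ → Set
Cell n = Fin n × Fin n

iter : {X : Set} → (X → X) → ℕ → X → X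
iter f zero x = x
iter f (suc m) x = f (iter f m x)

-- least k in [k₀, k₀ + fuel) with f k = true (default k₀ if none)
firstFrom : ℕ → ℕ → (ℕ → Bool) → ℕ
firstFrom zero k f = k
firstFrom (suc m) k f = if f k then k else firstFrom m (suc k) f

firstNeg : (n : ℕ) → Fin n → Sign
firstNeg (suc m) fzero = minus
firstNeg (suc m) (fsuc _) = plus

module _ (n : ℕ) .{{nz : NonZero n}} where

  md : ℕ → Fin n
  md m = fromℕ< (m%n<n m n)

  -- the paper's (1-based, modulo n) index a, as a position
  idx : ℕ → Fin n
  idx a = md (a + (n ∸ 1))

  Filled : Array n → Cell n → Set
  Filled A (i , j) = A i j ≡ true

  -- row successor: (i, j+k), k ≥ 1 minimal with (i, j+k) filled
  rowSucc : Array n → Cell n → Cell n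
  rowSucc A (i , j) = (i , md (toℕ j + firstFrom n 1 (λ k → A i (md (toℕ j + k)))))

  rowPred : Array n → Cell n → Cell n
  rowPred A (i , j) = (i , md (toℕ j + n ∸ firstFrom n 1 (λ k → A i (md (toℕ j + n ∸ k)))))

  colSucc : Array n → Cell n → Cell n
  colSucc A (i , j) = (md (toℕ i + firstFrom n 1 (λ k → A (md (toℕ i + k)) j)) , j)

  colPred : Array n → Cell n → Cell n
  colPred A (i , j) = (md (toℕ i + n ∸ firstFrom n 1 (λ k → A (md (toℕ i + n ∸ k)) j)) , j)

  rowStep : Array n → Sign → Cell n → Cell n
  rowStep A plus = rowSucc A
  rowStep A minus = rowPred A

  colStep : Array n → Sign → Cell n → Cell n
  colStep A plus = colSucc A
  colStep A minus = colPred A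

  move : Array n → (Fin n → Sign) → (Fin n → Sign) → Cell n → Cell n
  move A R C (i , j) =
    let c' = rowStep A (R i) (i , j) in colStep A (C (proj₂ c')) c'

  -- S is a single cycle on F(A): every filled cell reaches every filled cell
  -- (S is a permutation of F(A) by construction)
  SingleCycle : Array n → (Cell n → Cell n) → Set
  SingleCycle A f = ∀ x y → Filled A x → Filled A y → ∃ λ m → iter f m x ≡ y

  IsSolution : Array n → (Fin n → Sign) → (Fin n → Sign) → Set
  IsSolution A R C = SingleCycle A (move A R C)

  -- the t-th cell (t = 1..n) of diagonal D_i : (i + t - 1, t)
  diagCell : ℕ → Fin n → Cell n
  diagCell i t = (idx (i + suc (toℕ t) ∸ 1) , idx (suc (toℕ t)))

  OnDiag : ℕ → Fin n → Fin n → Set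
  OnDiag i r c = ∃ λ t → diagCell i t ≡ (r , c)

  DiagFilled : Array n → ℕ → Set
  DiagFilled A i = ∀ t → Filled A (diagCell i t)

  DiagEmpty : Array n → ℕ → Set
  DiagEmpty A i = ∀ t → A (proj₁ (diagCell i t)) (proj₂ (diagCell i t)) ≡ false

  -- k-diagonal: n ≥ k and the filled cells are exactly those of k distinct diagonals
  -- (position p ∈ S stands for diagonal D_{p+1})
  KDiagonal : ℕ → Array n → Set
  KDiagonal k A = k ≤ n × Σ (Subset n) λ S → ∣ S ∣ ≡ k ×
    (∀ r c → (A r c ≡ true) ⇔ (∃ λ p → p ∈ S × OnDiag (suc (toℕ p)) r c))

  EmptyStrip : Array n → ℕ → ℕ → Set
  EmptyStrip A r t = 1 ≤ t × DiagFilled A r × DiagFilled A (r + t + 1) ×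
    (∀ u → 1 ≤ u → u ≤ t → DiagEmpty A (r + u))

  HasWidth : Array n → ℕ → Set
  HasWidth A s = ∀ r t → EmptyStrip A r t → t ≡ s

  StandardForm : Array n → Set
  StandardForm A = DiagFilled A 1 × DiagEmpty A n

module Submission where

open import Defs
open import Data.Nat using (ℕ; zero; suc; _+_; _*_; _∸_; _%_; _≤_; _<_; z≤n; s≤s; s≤s⁻¹; NonZero)
open import Data.Nat.Properties
open import Data.Nat.DivMod
open import Data.Nat.Divisibility using (_∣_; divides; m%n≡0⇒n∣m; ∣⇒≤)
open import Data.Nat.GCD using (gcd; module Bézout)
open import Data.Nat.Coprimality
  using (Coprime; coprime-Bézout; coprime-divisor; gcd≡1⇒coprime; 1-coprimeTo)
  renaming (sym to coprime-sym)
open import Data.Nat.Tactic.RingSolver using (solve-∀)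
open import Data.Bool using (Bool; true; false)
open import Data.Fin using (Fin; toℕ) renaming (zero to fzero; suc to fsuc)
open import Data.Fin.Properties using (toℕ-fromℕ<; toℕ-injective; toℕ<n)
open import Data.Fin.Subset using (Subset; _∈_; ∣_∣)
open import Data.Vec using (Vec; []; _∷_; lookup)
open import Data.Vec.Properties using ([]=⇒lookup; lookup⇒[]=)
open import Data.Sign using () renaming (+ to plus)
open import Data.Product using (∃; _×_; _,_; proj₁; proj₂)
open import Data.Sum using (_⊎_; inj₁; inj₂)
open import Data.Empty using (⊥; ⊥-elim)
open import Function using (_⇔_; Equivalence)
open import Level using (0ℓ)
open import Relation.Nullary using (¬_)
open import Relation.Binary using (IsEquivalence; Setoid)
open import Relation.Binary.Definitions using (tri<; tri≈; tri>)
open import Relation.Binary.PropositionalEquality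
import Relation.Binary.Reasoning.Setoid as SetoidReasoning


-- Index diagonals by the offset e = r - c (mod n) of their cells: a cell is filled
-- iff its offset is filled.  For a filled offset e let gap e be the distance back to the previous
-- filled offset prev e = e - gap e.  From a filled cell (i, j) of diagonal e the row successor
-- lies on diagonal prev e, gap e columns to the right, and the column successor comes back down
-- to diagonal e: S moves by (gap e, gap e) along the diagonal, except when it lands in the first
-- column, where C₁ = -1 sends it up to the first column of diagonal prev (prev e).  The width
-- hypothesis gives gap e ∈ {1, s+1}, so gap e is a unit mod n: n moves from the first cell of
-- diagonal e visit all its cells and end at the first cell of diagonal prev (prev e).  prev is a
-- single cycle of length k on the filled offsets, and k is odd, so prev ∘ prev is one as well.

record LeastFrom (a : ℕ) (f : ℕ → Bool) (r : ℕ) : Set where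
  field
    lower : a ≤ r
    holds : f r ≡ true
    below : ∀ l → a ≤ l → l < r → f l ≡ false
open LeastFrom

true≢false : ∀ {b : Bool} → b ≡ true → b ≡ false → ⊥
true≢false refl ()

LeastFrom-≤ : ∀ {a f r v} → LeastFrom a f r → a ≤ v → f v ≡ true → r ≤ v
LeastFrom-≤ lf a≤v fv = ≮⇒≥ λ v<r → true≢false fv (below lf _ a≤v v<r)

LeastFrom-unique : ∀ {a f r r′} → LeastFrom a f r → LeastFrom a f r′ → r ≡ r′
LeastFrom-unique lf lf′ =
  ≤-antisym (LeastFrom-≤ lf (lower lf′) (holds lf′)) (LeastFrom-≤ lf′ (lower lf) (holds lf))

LeastFrom-skip : ∀ {a f r} → f a ≡ false → LeastFrom (suc a) f r → LeastFrom a f r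
LeastFrom-skip {a} {f} {r} fa lf =
  record { lower = ≤-trans (n≤1+n a) (lower lf) ; holds = holds lf ; below = below′ }
  where
  below′ : ∀ l → a ≤ l → l < r → f l ≡ false
  below′ l a≤l l<r with m≤n⇒m<n∨m≡n a≤l
  ... | inj₁ a<l = below lf l a<l l<r
  ... | inj₂ refl = fa

firstFrom-least : ∀ fuel a f v → a ≤ v → v < a + fuel → f v ≡ true →
  LeastFrom a f (firstFrom fuel a f)
firstFrom-least zero a f v a≤v v<a+0 fv =
  ⊥-elim (<⇒≱ (subst (v <_) (+-identityʳ a) v<a+0) a≤v)
firstFrom-least (suc fuel) a f v a≤v v<a+fuel fv with f a in fa
... | true = record { lower = ≤-refl ; holds = fa ; below = λ l a≤l l<a → ⊥-elim (<⇒≱ l<a a≤l) }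
... | false with m≤n⇒m<n∨m≡n a≤v
...   | inj₂ refl = ⊥-elim (true≢false fv fa)
...   | inj₁ a<v = LeastFrom-skip fa
        (firstFrom-least fuel (suc a) f v a<v (subst (v <_) (+-suc a fuel) v<a+fuel) fv)

firstFrom-≡ : ∀ fuel a f v → v < a + fuel → LeastFrom a f v → firstFrom fuel a f ≡ v
firstFrom-≡ fuel a f v v<a+fuel lf =
  LeastFrom-unique (firstFrom-least fuel a f v (lower lf) v<a+fuel (holds lf)) lf

firstFrom-cong : ∀ fuel a (f g : ℕ → Bool) → (∀ k → a ≤ k → k < a + fuel → f k ≡ g k) →
  firstFrom fuel a f ≡ firstFrom fuel a g
firstFrom-cong zero a f g f≗g = refl
firstFrom-cong (suc fuel) a f g f≗g
  rewrite f≗g a ≤-refl (subst (a <_) (sym (+-suc a fuel)) (s≤s (m≤m+n a fuel)))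
  with g a
... | true = refl
... | false = firstFrom-cong fuel (suc a) f g
      (λ k a<k k< → f≗g k (≤-trans (n≤1+n a) a<k) (subst (k <_) (sym (+-suc a fuel)) k<))

iter-add : ∀ {X : Set} (f : X → X) a b x → iter f (a + b) x ≡ iter f a (iter f b x)
iter-add f zero b x = refl
iter-add f (suc a) b x = cong f (iter-add f a b x)

iter-suc : ∀ {X : Set} (f : X → X) m x → iter f (suc m) x ≡ iter f m (f x)
iter-suc f zero x = refl
iter-suc f (suc m) x = cong f (iter-suc f m x)

iter-compose : ∀ {X : Set} (f : X → X) a b {x y z : X} →
  iter f a x ≡ y → iter f b y ≡ z → iter f (b + a) x ≡ z
iter-compose f a b {x} x↦y y↦z = trans (iter-add f b a x) (trans (cong (iter f b) x↦y) y↦z)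

iter-square : ∀ {X : Set} (f : X → X) h x → iter (λ y → f (f y)) h x ≡ iter f (h * 2) x
iter-square f zero x = refl
iter-square f (suc h) x = cong (λ y → f (f y)) (iter-square f h x)

even-or-odd : ∀ q → (∃ λ h → q ≡ h * 2) ⊎ (∃ λ h → q ≡ suc (h * 2))
even-or-odd zero = inj₁ (0 , refl)
even-or-odd (suc q) with even-or-odd q
... | inj₁ (h , q≡2h) = inj₂ (h , cong suc q≡2h)
... | inj₂ (h , q≡2h+1) = inj₁ (suc h , cong suc q≡2h+1)

odd-cycle-square : ∀ {X : Set} (f : X → X) a x → iter f (suc (a * 2)) x ≡ x →
  ∀ q → ∃ λ h → iter (λ y → f (f y)) h x ≡ iter f q x
odd-cycle-square f a x period q with even-or-odd q
... | inj₁ (h , q≡2h) = h , trans (iter-square f h x) (cong (λ c → iter f c x) (sym q≡2h))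
... | inj₂ (h , q≡2h+1) = suc (h + a) , (begin
  iter (λ y → f (f y)) (suc (h + a)) x          ≡⟨ iter-square f (suc (h + a)) x ⟩
  iter f (suc (h + a) * 2) x                    ≡⟨ cong (λ c → iter f c x) (double h a) ⟩
  iter f (suc (h * 2) + suc (a * 2)) x          ≡⟨ iter-add f (suc (h * 2)) (suc (a * 2)) x ⟩
  iter f (suc (h * 2)) (iter f (suc (a * 2)) x) ≡⟨ cong (iter f (suc (h * 2))) period ⟩
  iter f (suc (h * 2)) x                        ≡⟨ cong (λ c → iter f c x) q≡2h+1 ⟨
  iter f q x                                    ∎)
  where
  open ≡-Reasoning
  double : ∀ h a → suc (h + a) * 2 ≡ suc (h * 2) + suc (a * 2)
  double = solve-∀

indicator : Bool → ℕ
indicator true = 1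
indicator false = 0

count : (ℕ → Bool) → ℕ → ℕ
count f zero = 0
count f (suc d) = count f d + indicator (f d)

count-mono : ∀ f {a b} → a ≤ b → count f a ≤ count f b
count-mono f {b = zero} z≤n = ≤-refl
count-mono f {a} {suc b} a≤1+b with m≤n⇒m<n∨m≡n a≤1+b
... | inj₁ a<1+b = ≤-trans (count-mono f (s≤s⁻¹ a<1+b)) (m≤m+n _ _)
... | inj₂ refl = ≤-refl

count-step : ∀ f a → f a ≡ true → count f (suc a) ≡ suc (count f a)
count-step f a fa rewrite fa = +-comm (count f a) 1

count-flat : ∀ f a m → (∀ l → a ≤ l → l < m + a → f l ≡ false) → count f (m + a) ≡ count f a
count-flat f a zero none = refl
count-flat f a (suc m) none rewrite none (m + a) (m≤n+m a m) ≤-refl =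
  trans (+-identityʳ _) (count-flat f a m λ l a≤l l< → none l a≤l (m≤n⇒m≤1+n l<))

count-strict : ∀ f {a b} → f a ≡ true → a < b → suc (count f a) ≤ count f b
count-strict f {a} {b} fa a<b = subst (_≤ count f b) (count-step f a fa) (count-mono f a<b)

count-injective : ∀ f {a b} → f a ≡ true → f b ≡ true → count f a ≡ count f b → a ≡ b
count-injective f {a} {b} fa fb same with <-cmp a b
... | tri≈ _ a≡b _ = a≡b
... | tri< a<b _ _ = ⊥-elim (<-irrefl same (count-strict f fa a<b))
... | tri> _ _ b<a = ⊥-elim (<-irrefl (sym same) (count-strict f fb b<a))

count-cong : ∀ {f g} d → (∀ l → l < d → f l ≡ g l) → count f d ≡ count g d
count-cong zero f≗g = refl
count-cong (suc d) f≗g =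
  cong₂ _+_ (count-cong d λ l l<d → f≗g l (m<n⇒m<1+n l<d)) (cong indicator (f≗g d ≤-refl))

count-shift : ∀ f d → count f (suc d) ≡ indicator (f 0) + count (λ l → f (suc l)) d
count-shift f zero = +-comm 0 _
count-shift f (suc d) =
  trans (cong (_+ indicator (f (suc d))) (count-shift f d)) (+-assoc (indicator (f 0)) _ _)

-- a subset of Fin m read as a predicate on ℕ (false from m on)
lookupℕ : ∀ {m} → Vec Bool m → ℕ → Bool
lookupℕ [] _ = false
lookupℕ (x ∷ xs) zero = x
lookupℕ (x ∷ xs) (suc l) = lookupℕ xs l

lookup-ℕ : ∀ {m} (v : Vec Bool m) (p : Fin m) → lookup v p ≡ lookupℕ v (toℕ p)
lookup-ℕ (x ∷ xs) fzero = refl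
lookup-ℕ (x ∷ xs) (fsuc p) = lookup-ℕ xs p

size-count : ∀ {m} (S : Vec Bool m) → ∣ S ∣ ≡ count (lookupℕ S) m
size-count [] = refl
size-count {suc m} (true ∷ xs) = trans (cong suc (size-count xs)) (sym (count-shift _ m))
size-count {suc m} (false ∷ xs) = trans (size-count xs) (sym (count-shift _ m))

module Congruence (n' : ℕ) where
  n : ℕ
  n = suc n'

  infix 4 _≡ₙ_
  record _≡ₙ_ (a b : ℕ) : Set where
    constructor mod-eq
    field residue : a % n ≡ b % n
  open _≡ₙ_ public

  ≡ₙ-isEquivalence : IsEquivalence _≡ₙ_
  ≡ₙ-isEquivalence = record
    { refl = mod-eq refl
    ; sym = λ { (mod-eq p) → mod-eq (sym p) }
    ; trans = λ { (mod-eq p) (mod-eq q) → mod-eq (trans p q) }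
    }

  ≡ₙ-setoid : Setoid 0ℓ 0ℓ
  ≡ₙ-setoid = record { Carrier = ℕ ; _≈_ = _≡ₙ_ ; isEquivalence = ≡ₙ-isEquivalence }

  open IsEquivalence ≡ₙ-isEquivalence public
    using () renaming (refl to reflₙ; sym to symₙ; trans to transₙ; reflexive to ≡⇒ₙ)
  module ≡ₙ-Reasoning = SetoidReasoning ≡ₙ-setoid

  +-congₙ : ∀ {a b c d} → a ≡ₙ b → c ≡ₙ d → a + c ≡ₙ b + d
  +-congₙ {a} {b} {c} {d} (mod-eq p) (mod-eq q) = mod-eq (begin
    (a + c) % n         ≡⟨ %-distribˡ-+ a c n ⟩
    (a % n + c % n) % n ≡⟨ cong₂ (λ x y → (x + y) % n) p q ⟩
    (b % n + d % n) % n ≡⟨ %-distribˡ-+ b d n ⟨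
    (b + d) % n         ∎)
    where open ≡-Reasoning

  *-congₙ : ∀ {a b c d} → a ≡ₙ b → c ≡ₙ d → a * c ≡ₙ b * d
  *-congₙ {a} {b} {c} {d} (mod-eq p) (mod-eq q) = mod-eq (begin
    (a * c) % n             ≡⟨ %-distribˡ-* a c n ⟩
    (a % n * (c % n)) % n   ≡⟨ cong₂ (λ x y → (x * y) % n) p q ⟩
    (b % n * (d % n)) % n   ≡⟨ %-distribˡ-* b d n ⟨
    (b * d) % n             ∎)
    where open ≡-Reasoning

  %-≡ₙ : ∀ a → a % n ≡ₙ a
  %-≡ₙ a = mod-eq (m%n%n≡m%n a n)

  +n-≡ₙ : ∀ a → a + n ≡ₙ a
  +n-≡ₙ a = mod-eq ([m+n]%n≡m%n a n)

  +kn-≡ₙ : ∀ a k → a + k * n ≡ₙ a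
  +kn-≡ₙ a k = mod-eq ([m+kn]%n≡m%n a k n)

  +-cancelʳₙ : ∀ a b c → a + c ≡ₙ b + c → a ≡ₙ b
  +-cancelʳₙ a b c a+c≡b+c = begin
    a               ≈⟨ +kn-≡ₙ a c ⟨
    a + c * n       ≡⟨ unfold a ⟩
    a + c + c * n'  ≈⟨ +-congₙ a+c≡b+c reflₙ ⟩
    b + c + c * n'  ≡⟨ unfold b ⟨
    b + c * n       ≈⟨ +kn-≡ₙ b c ⟩
    b               ∎
    where
    open ≡ₙ-Reasoning
    unfold : ∀ x → x + c * n ≡ x + c + c * n'
    unfold x = trans (cong (x +_) (*-suc c n')) (sym (+-assoc x c (c * n')))

  +-cancelₙ : ∀ {a b u v} → a + u ≡ₙ b + v → u ≡ₙ v → a ≡ₙ b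
  +-cancelₙ {a} {b} {u} {v} a+u≡b+v u≡v =
    +-cancelʳₙ a b v (transₙ (+-congₙ (reflₙ {a}) (symₙ u≡v)) a+u≡b+v)

  -- truncated subtraction x + n ∸ g represents x - g (mod n) when g ≤ n
  sub-add : ∀ x g → g ≤ n → x + n ∸ g + g ≡ x + n
  sub-add x g g≤n = m∸n+n≡m (≤-trans g≤n (m≤n+m n x))

  sub-addₙ : ∀ x g → g ≤ n → x + n ∸ g + g ≡ₙ x
  sub-addₙ x g g≤n = transₙ (≡⇒ₙ (sub-add x g g≤n)) (+n-≡ₙ x)

  sub-congₙ : ∀ {x y} g → g ≤ n → x ≡ₙ y → x + n ∸ g ≡ₙ y + n ∸ g
  sub-congₙ {x} {y} g g≤n x≡y =
    +-cancelₙ (transₙ (sub-addₙ x g g≤n) (transₙ x≡y (symₙ (sub-addₙ y g g≤n)))) reflₙ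

  toℕ-md : ∀ a → toℕ (md n a) ≡ a % n
  toℕ-md a = toℕ-fromℕ< _

  toℕ-md-≡ₙ : ∀ a → toℕ (md n a) ≡ₙ a
  toℕ-md-≡ₙ a = transₙ (≡⇒ₙ (toℕ-md a)) (%-≡ₙ a)

  md-cong : ∀ {a b} → a ≡ₙ b → md n a ≡ md n b
  md-cong {a} {b} (mod-eq a≡b) = toℕ-injective (trans (toℕ-md a) (trans a≡b (sym (toℕ-md b))))

  toℕ%n : (i : Fin n) → toℕ i % n ≡ toℕ i
  toℕ%n i = m<n⇒m%n≡m (toℕ<n i)

  md-toℕ : (i : Fin n) → md n (toℕ i) ≡ i
  md-toℕ i = toℕ-injective (trans (toℕ-md (toℕ i)) (toℕ%n i))

  -- the offset of cell (i , j): the index (from 0) of the diagonal through it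
  offset : Fin n → Fin n → ℕ
  offset i j = toℕ i + n ∸ toℕ j

  offset-shift : ∀ (i j : Fin n) a b → a ≤ b → b ≤ n →
    offset (md n (toℕ i + a)) (md n (toℕ j + b)) ≡ₙ offset i j + n ∸ (b ∸ a)
  offset-shift i j a b a≤b b≤n = +-cancelₙ (transₙ moved (symₙ shifted)) columns
    where
    open ≡ₙ-Reasoning
    d : ℕ
    d = b ∸ a
    moved : offset (md n (toℕ i + a)) (md n (toℕ j + b)) + toℕ (md n (toℕ j + b)) ≡ₙ toℕ i + a
    moved = transₙ (sub-addₙ _ _ (<⇒≤ (toℕ<n (md n (toℕ j + b))))) (toℕ-md-≡ₙ (toℕ i + a))
    reassoc : ∀ x y z w → x + (y + (z + w)) ≡ x + y + z + w
    reassoc = solve-∀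
    shifted : offset i j + n ∸ d + (d + (toℕ j + a)) ≡ₙ toℕ i + a
    shifted = begin
      offset i j + n ∸ d + (d + (toℕ j + a)) ≡⟨ reassoc (offset i j + n ∸ d) d (toℕ j) a ⟩
      offset i j + n ∸ d + d + toℕ j + a     ≈⟨ +-congₙ (+-congₙ (sub-addₙ (offset i j) d
                                                  (≤-trans (m∸n≤m b a) b≤n)) reflₙ) reflₙ ⟩
      offset i j + toℕ j + a                 ≈⟨ +-congₙ (sub-addₙ (toℕ i) (toℕ j)
                                                  (<⇒≤ (toℕ<n j))) reflₙ ⟩
      toℕ i + a                              ∎
    swap : ∀ x y z → x + (y + z) ≡ y + (x + z)
    swap = solve-∀
    columns : toℕ (md n (toℕ j + b)) ≡ₙ d + (toℕ j + a)
    columns = begin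
      toℕ (md n (toℕ j + b)) ≈⟨ toℕ-md-≡ₙ (toℕ j + b) ⟩
      toℕ j + b              ≡⟨ cong (toℕ j +_) (m∸n+n≡m a≤b) ⟨
      toℕ j + (d + a)        ≡⟨ swap (toℕ j) d a ⟩
      d + (toℕ j + a)        ∎

  offset-shiftʳ : ∀ (i j : Fin n) k → k ≤ n → offset i (md n (toℕ j + k)) ≡ₙ offset i j + n ∸ k
  offset-shiftʳ i j k k≤n =
    subst (λ r → offset r (md n (toℕ j + k)) ≡ₙ offset i j + n ∸ k)
      (trans (cong (md n) (+-identityʳ (toℕ i))) (md-toℕ i)) (offset-shift i j 0 k z≤n k≤n)

  offset-diagonal : ∀ e t → offset (md n (e + t)) (md n t) ≡ₙ e
  offset-diagonal e t = +-cancelₙ {u = toℕ (md n t)} {v = t} (begin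
    offset (md n (e + t)) (md n t) + toℕ (md n t) ≈⟨ sub-addₙ _ _ (<⇒≤ (toℕ<n (md n t))) ⟩
    toℕ (md n (e + t))                            ≈⟨ toℕ-md-≡ₙ (e + t) ⟩
    e + t                                         ∎) (toℕ-md-≡ₙ t)
    where open ≡ₙ-Reasoning

-- A pattern f of filled residues 0 … n-1, read periodically: the gaps between consecutive
-- filled residues, and the map prev to the previous filled residue.
module GapCycle (n' : ℕ) (f : ℕ → Bool) where
  open Congruence n'

  filled : ℕ → Bool
  filled a = f (a % n)

  filled-cong : ∀ {a b} → a ≡ₙ b → filled a ≡ filled b
  filled-cong (mod-eq a≡b) = cong f a≡b

  gap : ℕ → ℕ
  gap e = firstFrom n 1 (λ k → filled (e + n ∸ k))

  -- for filled e the search succeeds (at k = n at the latest), and gap e ≤ n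
  gap-least : ∀ e → filled e ≡ true → LeastFrom 1 (λ k → filled (e + n ∸ k)) (gap e)
  gap-least e fe =
    firstFrom-least n 1 _ n (s≤s z≤n) ≤-refl (trans (cong filled (m+n∸n≡m e n)) fe)

  gap≤n : ∀ e → filled e ≡ true → gap e ≤ n
  gap≤n e fe = LeastFrom-≤ (gap-least e fe) (s≤s z≤n) (trans (cong filled (m+n∸n≡m e n)) fe)

  gap-cong : ∀ {e e′} → e ≡ₙ e′ → gap e ≡ gap e′
  gap-cong e≡e′ = firstFrom-cong n 1 _ _ λ k _ k<1+n → filled-cong (sub-congₙ k (s≤s⁻¹ k<1+n) e≡e′)

  prev : ℕ → ℕ
  prev e = (e + n ∸ gap e) % n

  prev² : ℕ → ℕ
  prev² e = prev (prev e)

  filled-% : ∀ a → filled a ≡ true → filled (a % n) ≡ true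
  filled-% a fa = trans (filled-cong (%-≡ₙ a)) fa

  prev-filled : ∀ e → filled e ≡ true → filled (prev e) ≡ true
  prev-filled e fe = trans (filled-cong (%-≡ₙ (e + n ∸ gap e))) (holds (gap-least e fe))

  prev<n : ∀ e → prev e < n
  prev<n e = m%n<n (e + n ∸ gap e) n

  prev-cong : ∀ {e e′} → filled e ≡ true → e ≡ₙ e′ → prev e ≡ prev e′
  prev-cong {e} {e′} fe e≡e′ = trans (residue (sub-congₙ (gap e) (gap≤n e fe) e≡e′))
    (cong (λ g → (e′ + n ∸ g) % n) (gap-cong e≡e′))

  iter-prev²-filled : ∀ h e → filled e ≡ true → filled (iter prev² h e) ≡ true
  iter-prev²-filled zero e fe = fe
  iter-prev²-filled (suc h) e fe =
    prev-filled _ (prev-filled _ (iter-prev²-filled h e fe))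

  rank : ℕ → ℕ
  rank = count filled

  -- If 0 is filled, prev runs down through the filled residues of [0, n) by decreasing rank and
  -- jumps from 0 to the top one: it is a single cycle of length rank n.
  module PrevCycle (filled-0 : filled 0 ≡ true) where

    filled-n : filled n ≡ true
    filled-n = trans (cong f (n%n≡0 n)) filled-0

    -- searching back from d ≥ 1 stops at or above the filled residue 0
    gap≤ : ∀ d → 1 ≤ d → filled d ≡ true → gap d ≤ d
    gap≤ d 1≤d fd =
      LeastFrom-≤ (gap-least d fd) 1≤d (trans (cong filled (m+n∸m≡n d n)) filled-n)

    back-filled : ∀ d → 1 ≤ d → filled d ≡ true → filled (d ∸ gap d) ≡ true
    back-filled d 1≤d fd = trans (filled-cong (symₙ (+n-≡ₙ (d ∸ gap d))))
      (trans (cong filled (sym (+-∸-comm n (gap≤ d 1≤d fd)))) (holds (gap-least d fd)))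

    rank-step-back : ∀ d → 1 ≤ d → filled d ≡ true → suc (rank (d ∸ gap d)) ≡ rank d
    rank-step-back d 1≤d fd = sym (begin
      rank d                  ≡⟨ cong rank d≡ ⟨
      rank ((g ∸ 1) + suc a)  ≡⟨ count-flat filled (suc a) (g ∸ 1) strictly-between ⟩
      rank (suc a)            ≡⟨ count-step filled a (back-filled d 1≤d fd) ⟩
      suc (rank a)            ∎)
      where
      open ≡-Reasoning
      g a : ℕ
      g = gap d
      a = d ∸ g
      g≤d : g ≤ d
      g≤d = gap≤ d 1≤d fd
      d≡ : (g ∸ 1) + suc a ≡ d
      d≡ = trans (+-suc (g ∸ 1) a) (trans (cong (_+ a)
        (trans (+-comm 1 (g ∸ 1)) (m∸n+n≡m (lower (gap-least d fd))))) (m+[n∸m]≡n g≤d))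
      strictly-between : ∀ l → suc a ≤ l → l < (g ∸ 1) + suc a → filled l ≡ false
      strictly-between l a<l l<d′ = trans (filled-cong (symₙ (+n-≡ₙ l)))
        (trans (cong filled l+n≡) (below (gap-least d fd) (d ∸ l) (m<n⇒0<n∸m l<d)
          (subst (d ∸ l <_) (m∸[m∸n]≡n g≤d) (∸-monoʳ-< a<l (<⇒≤ l<d)))))
        where
        l<d : l < d
        l<d = subst (l <_) d≡ l<d′
        l+n≡ : l + n ≡ d + n ∸ (d ∸ l)
        l+n≡ = trans (cong (_+ n) (sym (m∸[m∸n]≡n (<⇒≤ l<d)))) (sym (+-∸-comm n (m∸n≤m d l)))

    prev-below : ∀ d → 1 ≤ d → d < n → filled d ≡ true → prev d ≡ d ∸ gap d
    prev-below d 1≤d d<n fd = trans (cong (_% n) (+-∸-comm n (gap≤ d 1≤d fd)))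
      (trans ([m+n]%n≡m%n (d ∸ gap d) n) (m<n⇒m%n≡m (≤-<-trans (m∸n≤m d (gap d)) d<n)))

    prev-rank : ∀ d → 1 ≤ d → d < n → filled d ≡ true → suc (rank (prev d)) ≡ rank d
    prev-rank d 1≤d d<n fd =
      trans (cong (λ p → suc (rank p)) (prev-below d 1≤d d<n fd)) (rank-step-back d 1≤d fd)

    -- the largest filled residue, reached from 0
    top : ℕ
    top = prev 0

    rank-top : suc (rank top) ≡ rank n
    rank-top = trans (cong (λ t → suc (rank t)) top≡) (rank-step-back n (s≤s z≤n) filled-n)
      where
      top≡ : top ≡ n ∸ gap n
      top≡ = trans (cong (λ g → (n ∸ g) % n) (gap-cong {0} {n} (mod-eq (sym (n%n≡0 n)))))
        (m<n⇒m%n≡m (∸-monoʳ-< {n} {gap n} {0} (lower (gap-least n filled-n)) (gap≤n n filled-n)))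

    rank≤top : ∀ d → filled d ≡ true → d < n → rank d ≤ rank top
    rank≤top d fd d<n = s≤s⁻¹ (subst (suc (rank d) ≤_) (sym rank-top) (count-strict filled fd d<n))

    to-zero : ∀ c d → filled d ≡ true → d < n → rank d ≡ c → iter prev c d ≡ 0
    to-zero zero d fd d<n rank≡0 = count-injective filled fd filled-0 rank≡0
    to-zero (suc c) zero fd d<n ()
    to-zero (suc c) (suc d) fd d<n rank≡ = trans (iter-suc prev c (suc d))
      (to-zero c (prev (suc d)) (prev-filled (suc d) fd) (prev<n (suc d))
        (suc-injective (trans (prev-rank (suc d) (s≤s z≤n) d<n fd) rank≡)))

    from-top : ∀ j → j ≤ rank top → let x = iter prev j top in
      filled x ≡ true × x < n × rank x + j ≡ rank top
    from-top zero _ = prev-filled 0 filled-0 , prev<n 0 , +-identityʳ (rank top)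
    from-top (suc j) j<r with from-top j (≤-trans (n≤1+n j) j<r)
    ... | fx , x<n , rx with iter prev j top
    ...   | zero = ⊥-elim (<-irrefl rx j<r)
    ...   | suc x = prev-filled (suc x) fx , prev<n (suc x) ,
            trans (+-suc _ j) (trans (cong (_+ j) (prev-rank (suc x) (s≤s z≤n) x<n fx)) rx)

    -- so prev reaches e from top, and any filled e from any filled d (via 0 and top)
    top-reaches : ∀ e → filled e ≡ true → e < n → iter prev (rank top ∸ rank e) top ≡ e
    top-reaches e fe e<n with from-top (rank top ∸ rank e) (m∸n≤m (rank top) (rank e))
    ... | fx , _ , rx = count-injective filled fx fe (+-cancelʳ-≡ _ _ _
          (trans rx (sym (m+[n∸m]≡n (rank≤top e fe e<n)))))

    prev-reaches : ∀ d e → filled d ≡ true → d < n → filled e ≡ true → e < n →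
      iter prev ((rank top ∸ rank e) + suc (rank d)) d ≡ e
    prev-reaches d e fd d<n fe e<n = iter-compose prev (suc (rank d)) (rank top ∸ rank e)
      (cong prev (to-zero (rank d) d fd d<n refl)) (top-reaches e fe e<n)

    -- the cycle has length rank n: d → 0 → top → d
    prev-period : ∀ d → filled d ≡ true → d < n → iter prev (rank n) d ≡ d
    prev-period d fd d<n = trans (cong (λ c → iter prev c d) rank-n≡) (prev-reaches d d fd d<n fd d<n)
      where
      rank-n≡ : rank n ≡ (rank top ∸ rank d) + suc (rank d)
      rank-n≡ = trans (sym rank-top) (trans (cong suc (sym (m∸n+n≡m (rank≤top d fd d<n))))
        (sym (+-suc _ (rank d))))

    prev²-reaches : (∃ λ a → rank n ≡ suc (a * 2)) → ∀ d e → filled d ≡ true → d < n →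
      filled e ≡ true → e < n → ∃ λ h → iter prev² h d ≡ e
    prev²-reaches (a , odd) d e fd d<n fe e<n
      with odd-cycle-square prev a d (subst (λ c → iter prev c d ≡ d) odd (prev-period d fd d<n))
             ((rank top ∸ rank e) + suc (rank d))
    ... | h , square = h , trans square (prev-reaches d e fd d<n fe e<n)

module Units (n' : ℕ) where
  open Congruence n'

  -- m·g ≢ 0 (mod n) for 0 < m < n, as n ∣ m·g forces n ∣ m
  multiple-nonzero : ∀ {g} → Coprime n g → ∀ m → 1 ≤ m → m < n → (m * g) % n ≢ 0
  multiple-nonzero {g} coprime (suc m) _ m<n m*g≡0 = <⇒≱ m<n
    (∣⇒≤ (coprime-divisor coprime (subst (n ∣_) (*-comm (suc m) g) (m%n≡0⇒n∣m _ n m*g≡0))))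

  -- a Bézout identity gives an inverse of g modulo n
  inverse : ∀ {g} → Coprime n g → ∃ λ y → y * g ≡ₙ 1
  inverse {g} coprime with coprime-Bézout coprime
  ... | Bézout.-+ x y 1+xn≡yg = y , transₙ (≡⇒ₙ (sym 1+xn≡yg)) (+kn-≡ₙ 1 x)
  ... | Bézout.+- x y 1+yg≡xn = n' * y , (begin
    n' * y * g             ≈⟨ +n-≡ₙ _ ⟨
    n' * y * g + n         ≡⟨ expand n' y g ⟩
    suc (n' * (1 + y * g)) ≡⟨ cong (λ z → suc (n' * z)) 1+yg≡xn ⟩
    suc (n' * (x * n))     ≡⟨ regroup n' x ⟩
    1 + n' * x * n         ≈⟨ +kn-≡ₙ 1 (n' * x) ⟩
    1                      ∎)
    where
    open ≡ₙ-Reasoning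
    expand : ∀ c y g → c * y * g + suc c ≡ suc (c * (1 + y * g))
    expand = solve-∀
    regroup : ∀ c x → suc (c * (x * suc c)) ≡ 1 + c * x * suc c
    regroup = solve-∀

  multiples-cover : ∀ {g} → Coprime n g → ∀ c → c < n → ∃ λ m → m < n × (m * g) % n ≡ c
  multiples-cover {g} coprime c c<n with inverse coprime
  ... | y , yg≡1 = (c * y) % n , m%n<n (c * y) n , trans (residue (begin
    (c * y) % n * g ≈⟨ *-congₙ (%-≡ₙ (c * y)) reflₙ ⟩
    c * y * g       ≡⟨ *-assoc c y g ⟩
    c * (y * g)     ≈⟨ *-congₙ (reflₙ {c}) yg≡1 ⟩
    c * 1           ≡⟨ *-identityʳ c ⟩
    c               ∎)) (m<n⇒m%n≡m c<n)
    where open ≡ₙ-Reasoning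

firstNeg-later : ∀ {m} (c : Fin (suc m)) → toℕ c ≢ 0 → firstNeg (suc m) c ≡ plus
firstNeg-later fzero c≢0 = ⊥-elim (c≢0 refl)
firstNeg-later (fsuc c) _ = refl

-- The moves of an array filled exactly along the diagonals whose offset is filled.
module Walk (n' : ℕ) (A : Array (suc n')) (f : ℕ → Bool)
  (cells : ∀ r c → A r c ≡ GapCycle.filled n' f (Congruence.offset n' r c)) where
  open Congruence n'
  open GapCycle n' f

  step : Cell n → Cell n
  step = move n A (λ _ → plus) (firstNeg n)

  rowSucc-offset : ∀ i j → rowSucc n A (i , j) ≡ (i , md n (toℕ j + gap (offset i j)))
  rowSucc-offset i j = cong (λ g → (i , md n (toℕ j + g))) (firstFrom-cong n 1 _ _ λ k _ k<1+n →
    trans (cells i _) (filled-cong (offset-shiftʳ i j k (s≤s⁻¹ k<1+n))))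

  colSucc-offset : ∀ i j → filled (offset i j) ≡ true → let g = gap (offset i j) in
    colSucc n A (i , md n (toℕ j + g)) ≡ (md n (toℕ i + g) , md n (toℕ j + g))
  colSucc-offset i j fe = cong (λ k → (md n (toℕ i + k) , j′))
    (firstFrom-≡ n 1 _ g (s≤s (gap≤n _ fe)) returns)
    where
    g : ℕ
    g = gap (offset i j)
    j′ : Fin n
    j′ = md n (toℕ j + g)
    lf : LeastFrom 1 (λ k → filled (offset i j + n ∸ k)) g
    lf = gap-least (offset i j) fe
    down : ∀ k → k ≤ g → A (md n (toℕ i + k)) j′ ≡ filled (offset i j + n ∸ (g ∸ k))
    down k k≤g = trans (cells _ _) (filled-cong (offset-shift i j k g k≤g (gap≤n _ fe)))
    returns : LeastFrom 1 (λ k → A (md n (toℕ i + k)) j′) g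
    returns = record
      { lower = lower lf
      ; holds = trans (down g ≤-refl) (trans (cong (λ z → filled (offset i j + n ∸ z)) (n∸n≡0 g))
          (trans (filled-cong (+n-≡ₙ (offset i j))) fe))
      ; below = λ l 1≤l l<g → trans (down l (<⇒≤ l<g))
          (below lf (g ∸ l) (m<n⇒0<n∸m l<g) (∸-monoʳ-< {g} {l} {0} 1≤l (<⇒≤ l<g)))
      }

  colPred-first : ∀ i → colPred n A (i , fzero) ≡ (md n (prev (toℕ i)) , fzero)
  colPred-first i = cong (_, fzero)
    (trans (cong (λ g → md n (toℕ i + n ∸ g)) search≡)
      (md-cong (symₙ (%-≡ₙ (toℕ i + n ∸ gap (toℕ i))))))
    where
    search≡ : firstFrom n 1 (λ k → A (md n (toℕ i + n ∸ k)) fzero) ≡ gap (toℕ i)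
    search≡ = firstFrom-cong n 1 _ _ λ k _ _ →
      trans (cells _ fzero)
        (filled-cong (transₙ (+n-≡ₙ (toℕ (md n (toℕ i + n ∸ k)))) (toℕ-md-≡ₙ (toℕ i + n ∸ k))))

  step-along : ∀ i j → filled (offset i j) ≡ true → (toℕ j + gap (offset i j)) % n ≢ 0 →
    step (i , j) ≡ (md n (toℕ i + gap (offset i j)) , md n (toℕ j + gap (offset i j)))
  step-along i j fe off-first = begin
    step (i , j)                            ≡⟨ cong (λ c → colStep n A (firstNeg n (proj₂ c)) c)
                                                 (rowSucc-offset i j) ⟩
    colStep n A (firstNeg n j′) (i , j′)    ≡⟨ cong (λ σ → colStep n A σ (i , j′))
                                                 (firstNeg-later j′ λ j′≡0 →
                                                   off-first (trans (sym (toℕ-md (toℕ j + gap (offset i j)))) j′≡0)) ⟩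
    colSucc n A (i , j′)                    ≡⟨ colSucc-offset i j fe ⟩
    (md n (toℕ i + gap (offset i j)) , j′)  ∎
    where
    open ≡-Reasoning
    j′ : Fin n
    j′ = md n (toℕ j + gap (offset i j))

  step-wrap : ∀ i j → (toℕ j + gap (offset i j)) % n ≡ 0 →
    step (i , j) ≡ (md n (prev (toℕ i)) , fzero)
  step-wrap i j at-first = begin
    step (i , j)                            ≡⟨ cong (λ c → colStep n A (firstNeg n (proj₂ c)) c)
                                                 (rowSucc-offset i j) ⟩
    colStep n A (firstNeg n j′) (i , j′)    ≡⟨ cong (λ c → colStep n A (firstNeg n c) (i , c)) j′≡0 ⟩
    colPred n A (i , fzero)                 ≡⟨ colPred-first i ⟩
    (md n (prev (toℕ i)) , fzero)           ∎
    where
    open ≡-Reasoning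
    j′ : Fin n
    j′ = md n (toℕ j + gap (offset i j))
    j′≡0 : j′ ≡ fzero
    j′≡0 = toℕ-injective (trans (toℕ-md (toℕ j + gap (offset i j))) at-first)

  start : ℕ → Cell n
  start e = (md n e , fzero)

  -- Under the conclusions drawn from the hypotheses (offset 0 filled, every gap a unit,
  -- an odd number of filled offsets) the move function is a single cycle.
  module Cycle (filled-0 : filled 0 ≡ true)
    (unit-gaps : ∀ e → filled e ≡ true → Coprime n (gap e))
    (odd-rank : ∃ λ a → rank n ≡ suc (a * 2)) where
    open PrevCycle filled-0
    open Units n'

    diagonal-step : ∀ e t → filled e ≡ true → (t + gap e) % n ≢ 0 →
      step (md n (e + t) , md n t) ≡ (md n (e + (t + gap e)) , md n (t + gap e))
    diagonal-step e t fe off-first = trans (step-along i j fi λ z → off-first (trans (sym (residue col)) z))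
      (cong₂ _,_ (md-cong row) (md-cong col))
      where
      i j : Fin n
      i = md n (e + t)
      j = md n t
      gap≡ : gap (offset i j) ≡ gap e
      gap≡ = gap-cong (offset-diagonal e t)
      fi : filled (offset i j) ≡ true
      fi = trans (filled-cong (offset-diagonal e t)) fe
      col : toℕ j + gap (offset i j) ≡ₙ t + gap e
      col = +-congₙ (toℕ-md-≡ₙ t) (≡⇒ₙ gap≡)
      row : toℕ i + gap (offset i j) ≡ₙ e + (t + gap e)
      row = transₙ (+-congₙ (toℕ-md-≡ₙ (e + t)) (≡⇒ₙ gap≡)) (≡⇒ₙ (+-assoc e t (gap e)))

    diagonal-wrap : ∀ e t → filled e ≡ true → (t + gap e) % n ≡ 0 →
      step (md n (e + t) , md n t) ≡ start (prev² e)
    diagonal-wrap e t fe at-first = trans (step-wrap i j (trans (residue col) at-first))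
      (cong (λ r → (md n r , fzero)) (sym (prev-cong (prev-filled e fe) row≡prev)))
      where
      open ≡ₙ-Reasoning
      i j : Fin n
      i = md n (e + t)
      j = md n t
      col : toℕ j + gap (offset i j) ≡ₙ t + gap e
      col = +-congₙ (toℕ-md-≡ₙ t) (≡⇒ₙ (gap-cong (offset-diagonal e t)))
      turned : e + t + gap e ≡ₙ e
      turned = transₙ (≡⇒ₙ (+-assoc e t (gap e)))
        (transₙ (+-congₙ (reflₙ {e}) (mod-eq at-first)) (≡⇒ₙ (+-identityʳ e)))
      row≡prev : prev e ≡ₙ toℕ i
      row≡prev = begin
        prev e          ≈⟨ %-≡ₙ _ ⟩
        e + n ∸ gap e   ≈⟨ +-cancelₙ (transₙ (sub-addₙ e (gap e) (gap≤n e fe)) (symₙ turned)) reflₙ ⟩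
        e + t           ≈⟨ toℕ-md-≡ₙ (e + t) ⟨
        toℕ i           ∎

    walk : ∀ e → filled e ≡ true → ∀ m → m < n →
      iter step m (start e) ≡ (md n (e + m * gap e) , md n (m * gap e))
    walk e fe zero _ = cong (λ r → (md n r , fzero)) (sym (+-identityʳ e))
    walk e fe (suc m) m<n = trans (cong step (walk e fe m (<-trans (n<1+n m) m<n)))
      (trans (diagonal-step e (m * gap e) fe off-first)
        (cong (λ t → (md n (e + t) , md n t)) (+-comm (m * gap e) (gap e))))
      where
      off-first : (m * gap e + gap e) % n ≢ 0
      off-first = subst (λ t → t % n ≢ 0) (+-comm (gap e) (m * gap e))
        (multiple-nonzero (unit-gaps e fe) (suc m) (s≤s z≤n) m<n)

    round : ∀ e → filled e ≡ true → iter step n (start e) ≡ start (prev² e)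
    round e fe = trans (cong step (walk e fe n' ≤-refl)) (diagonal-wrap e (n' * gap e) fe full-turn)
      where
      full-turn : (n' * gap e + gap e) % n ≡ 0
      full-turn = trans (cong (_% n) (trans (+-comm (n' * gap e) (gap e)) (*-comm n (gap e))))
        (m*n%n≡0 (gap e) n)

    rounds : ∀ h e → filled e ≡ true → iter step (h * n) (start e) ≡ start (iter prev² h e)
    rounds zero e fe = refl
    rounds (suc h) e fe = trans (iter-add step n (h * n) (start e))
      (trans (cong (iter step n) (rounds h e fe)) (round _ (iter-prev²-filled h e fe)))

    locate : ∀ i j → filled (offset i j) ≡ true →
      ∃ λ m → m < n × iter step m (start (offset i j % n)) ≡ (i , j)
    locate i j fe with multiples-cover (unit-gaps _ (filled-% (offset i j) fe)) (toℕ j) (toℕ<n j)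
    ... | m , m<n , m*g≡j = m , m<n , trans (walk d (filled-% (offset i j) fe) m m<n) (cong₂ _,_ row col)
      where
      open ≡ₙ-Reasoning
      d : ℕ
      d = offset i j % n
      col : md n (m * gap d) ≡ j
      col = toℕ-injective (trans (toℕ-md (m * gap d)) m*g≡j)
      row : md n (d + m * gap d) ≡ i
      row = trans (md-cong (begin
        d + m * gap d                ≈⟨ +-congₙ (%-≡ₙ (offset i j)) (symₙ (%-≡ₙ (m * gap d))) ⟩
        offset i j + (m * gap d) % n ≡⟨ cong (offset i j +_) m*g≡j ⟩
        offset i j + toℕ j           ≈⟨ sub-addₙ (toℕ i) (toℕ j) (<⇒≤ (toℕ<n j)) ⟩
        toℕ i                        ∎)) (md-toℕ i)

    complete-round : ∀ e m {x} → filled e ≡ true → m ≤ n → iter step m (start e) ≡ x →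
      iter step (n ∸ m) x ≡ start (prev² e)
    complete-round e m {x} fe m≤n start↦x = begin
      iter step (n ∸ m) x                         ≡⟨ cong (iter step (n ∸ m)) start↦x ⟨
      iter step (n ∸ m) (iter step m (start e))   ≡⟨ iter-add step (n ∸ m) m (start e) ⟨
      iter step (n ∸ m + m) (start e)             ≡⟨ cong (λ c → iter step c (start e)) (m∸n+n≡m m≤n) ⟩
      iter step n (start e)                       ≡⟨ round e fe ⟩
      start (prev² e)                             ∎
      where open ≡-Reasoning

    between : ∀ d e → filled d ≡ true → d < n → filled e ≡ true → e < n →
      ∃ λ m → iter step m (start d) ≡ start e
    between d e fd d<n fe e<n with prev²-reaches odd-rank d e fd d<n fe e<n
    ... | h , d↦e = h * n , trans (rounds h d fd) (cong start d↦e)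

    -- from (i , j): finish its round, go round to the diagonal of (i′ , j′), walk to it
    connect : ∀ i j i′ j′ → filled (offset i j) ≡ true → filled (offset i′ j′) ≡ true →
      ∃ λ m → iter step m (i , j) ≡ (i′ , j′)
    connect i j i′ j′ fe fe′ =
      let (m₁ , m₁<n , start↦ij) = locate i j fe
          (m₂ , across) = between (prev² (offset i j % n)) (offset i′ j′ % n)
            (prev-filled _ (prev-filled _ (filled-% (offset i j) fe))) (prev<n _)
            (filled-% (offset i′ j′) fe′) (m%n<n (offset i′ j′) n)
          (m₃ , _ , start↦i′j′) = locate i′ j′ fe′
          out = complete-round (offset i j % n) m₁ (filled-% (offset i j) fe) (<⇒≤ m₁<n) start↦ij
      in m₃ + (m₂ + (n ∸ m₁)) ,
         iter-compose step (m₂ + (n ∸ m₁)) m₃ (iter-compose step (n ∸ m₁) m₂ out across) start↦i′j′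

    single-cycle : SingleCycle n A step
    single-cycle (i , j) (i′ , j′) ij-filled i′j′-filled =
      connect i j i′ j′ (trans (sym (cells i j)) ij-filled) (trans (sym (cells i′ j′)) i′j′-filled)

bool-ext : ∀ {a b : Bool} → (a ≡ true → b ≡ true) → (b ≡ true → a ≡ true) → a ≡ b
bool-ext {true} {true} _ _ = refl
bool-ext {false} {false} _ _ = refl
bool-ext {true} {false} a⇒b _ = sym (a⇒b refl)
bool-ext {false} {true} _ b⇒a = b⇒a refl

-- The hypotheses of the theorem, read through offsets: S is the set of filled diagonals,
-- position p of S standing for diagonal D_{p+1}, i.e. offset p.
module KDiagonalArray (n' : ℕ) (A : Array (suc n')) (S : Subset (suc n'))
  (diagonals : ∀ r c → (A r c ≡ true) ⇔ (∃ λ p → p ∈ S × OnDiag (suc n') (suc (toℕ p)) r c)) where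
  open Congruence n'
  open GapCycle n' (lookupℕ S)

  diagCell-offset : ∀ i t → let (r , c) = diagCell n i t in offset r c ≡ₙ i + n'
  diagCell-offset i t =
    subst (λ r → offset r (md n (suc (toℕ t) + n')) ≡ₙ i + n')
      (md-cong (transₙ (≡⇒ₙ (regroup i (toℕ t) n'))
        (transₙ (+n-≡ₙ _) (≡⇒ₙ (cong (λ x → x ∸ 1 + n') (sym (+-suc i (toℕ t))))))))
      (offset-diagonal (i + n') (suc (toℕ t) + n'))
    where
    regroup : ∀ i t m → i + m + (suc t + m) ≡ i + t + m + suc m
    regroup = solve-∀

  filled-position : (p : Fin n) → filled (toℕ p) ≡ lookup S p
  filled-position p = trans (cong (lookupℕ S) (toℕ%n p)) (sym (lookup-ℕ S p))

  cells : ∀ r c → A r c ≡ filled (offset r c)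
  cells r c = bool-ext on-member (λ fo → Equivalence.from (diagonals r c) (member fo))
    where
    on-member : A r c ≡ true → filled (offset r c) ≡ true
    on-member Arc with Equivalence.to (diagonals r c) Arc
    ... | p , p∈S , t , refl = trans (filled-cong at-p) (trans (filled-position p) ([]=⇒lookup p∈S))
      where
      at-p : offset r c ≡ₙ toℕ p
      at-p = transₙ (diagCell-offset (suc (toℕ p)) t)
        (transₙ (≡⇒ₙ (sym (+-suc (toℕ p) n'))) (+n-≡ₙ (toℕ p)))
    member : filled (offset r c) ≡ true → ∃ λ p → p ∈ S × OnDiag n (suc (toℕ p)) r c
    member fo = p , lookup⇒[]= p S (trans (sym (filled-position p)) 
        (trans (cong filled (toℕ-md (offset r c))) (filled-% (offset r c) fo))) ,
      c , cong₂ _,_ row col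
      where
      open ≡ₙ-Reasoning
      p : Fin n
      p = md n (offset r c)
      col : md n (suc (toℕ c) + n') ≡ c
      col = trans (md-cong (transₙ (≡⇒ₙ (sym (+-suc (toℕ c) n'))) (+n-≡ₙ (toℕ c)))) (md-toℕ c)
      regroup : ∀ p c m → p + suc c + m ≡ p + c + suc m
      regroup = solve-∀
      row : md n (suc (toℕ p) + suc (toℕ c) ∸ 1 + n') ≡ r
      row = trans (md-cong (begin
        toℕ p + suc (toℕ c) + n' ≡⟨ regroup (toℕ p) (toℕ c) n' ⟩
        toℕ p + toℕ c + n        ≈⟨ +n-≡ₙ _ ⟩
        toℕ p + toℕ c            ≈⟨ +-congₙ (toℕ-md-≡ₙ (offset r c)) reflₙ ⟩
        offset r c + toℕ c       ≈⟨ sub-addₙ (toℕ r) (toℕ c) (<⇒≤ (toℕ<n c)) ⟩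
        toℕ r                    ∎)) (md-toℕ r)

  diagonal-cells : ∀ i t → A (proj₁ (diagCell n i t)) (proj₂ (diagCell n i t)) ≡ filled (i + n')
  diagonal-cells i t = trans (cells _ _) (filled-cong (diagCell-offset i t))

  standard-filled-0 : StandardForm n A → filled 0 ≡ true
  standard-filled-0 (D₁-filled , _) = trans (filled-cong (symₙ (+n-≡ₙ 0)))
    (trans (sym (diagonal-cells 1 fzero)) (D₁-filled fzero))

  gap-strip : ∀ e t → filled e ≡ true → gap e ≡ suc t → 1 ≤ t →
    EmptyStrip n A (e + n ∸ gap e + 1) t
  gap-strip e t fe g≡ 1≤t = 1≤t , before , after , inside
    where
    a : ℕ
    a = e + n ∸ gap e
    lf : LeastFrom 1 (λ k → filled (e + n ∸ k)) (gap e)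
    lf = gap-least e fe
    before : DiagFilled n A (a + 1)
    before t′ = trans (diagonal-cells (a + 1) t′)
      (trans (filled-cong (transₙ (≡⇒ₙ (+-assoc a 1 n')) (+n-≡ₙ a))) (holds lf))
    closing : ∀ a t m → a + 1 + t + 1 + m ≡ a + suc t + suc m
    closing = solve-∀
    after : DiagFilled n A (a + 1 + t + 1)
    after t′ = trans (diagonal-cells (a + 1 + t + 1) t′) (trans (filled-cong (begin
      a + 1 + t + 1 + n' ≡⟨ closing a t n' ⟩
      a + suc t + n      ≈⟨ +n-≡ₙ _ ⟩
      a + suc t          ≡⟨ cong (a +_) g≡ ⟨
      a + gap e          ≈⟨ sub-addₙ e (gap e) (gap≤n e fe) ⟩
      e                  ∎)) fe)
      where open ≡ₙ-Reasoning
    opening : ∀ a u m → a + 1 + u + m ≡ a + u + suc m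
    opening = solve-∀
    inside : ∀ u → 1 ≤ u → u ≤ t → DiagEmpty n A (a + 1 + u)
    inside u 1≤u u≤t t′ = trans (diagonal-cells (a + 1 + u) t′) (trans (filled-cong (begin
      a + 1 + u + n'         ≡⟨ opening a u n' ⟩
      a + u + n              ≈⟨ +n-≡ₙ _ ⟩
      a + u                  ≡⟨ back ⟩
      e + n ∸ (gap e ∸ u)    ∎))
      (below lf (gap e ∸ u) (m<n⇒0<n∸m u<g) (∸-monoʳ-< {gap e} {u} {0} 1≤u (<⇒≤ u<g))))
      where
      open ≡ₙ-Reasoning
      u<g : u < gap e
      u<g = subst (u <_) (sym g≡) (s≤s u≤t)
      back : a + u ≡ e + n ∸ (gap e ∸ u)
      back = +-cancelʳ-≡ (gap e ∸ u) _ _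
        (trans (+-assoc a u (gap e ∸ u)) (trans (cong (a +_) (m+[n∸m]≡n (<⇒≤ u<g)))
          (trans (sub-add e (gap e) (gap≤n e fe))
            (sym (sub-add e (gap e ∸ u) (≤-trans (m∸n≤m (gap e) u) (gap≤n e fe)))))))

  gaps-coprime : ∀ s → HasWidth n A s → gcd n (s + 1) ≡ 1 →
    ∀ e → filled e ≡ true → Coprime n (gap e)
  gaps-coprime s width gcd≡1 e fe with gap e in g≡ | lower (gap-least e fe)
  ... | suc zero | _ = coprime-sym (1-coprimeTo n)
  ... | suc (suc t) | _ = gcd≡1⇒coprime (subst (λ z → gcd n z ≡ 1) s+1≡g gcd≡1)
    where
    s+1≡g : s + 1 ≡ suc (suc t)
    s+1≡g = trans (+-comm s 1) (cong suc (sym (width (e + n ∸ gap e + 1) (suc t) (gap-strip e (suc t) fe g≡ (s≤s z≤n)))))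

  odd-rank : ∀ k → ∣ S ∣ ≡ k → ¬ (2 ∣ k) → ∃ λ a → rank n ≡ suc (a * 2)
  odd-rank k size≡k k-odd with even-or-odd k
  ... | inj₁ (h , k≡2h) = ⊥-elim (k-odd (divides h k≡2h))
  ... | inj₂ (h , k≡2h+1) = h , (begin
    rank n                 ≡⟨ count-cong n (λ l l<n → cong (lookupℕ S) (m<n⇒m%n≡m l<n)) ⟩
    count (lookupℕ S) n    ≡⟨ size-count S ⟨
    ∣ S ∣                  ≡⟨ size≡k ⟩
    k                      ≡⟨ k≡2h+1 ⟩
    suc (h * 2)            ∎)
    where open ≡-Reasoning

-- k < n excludes n = 0; the hypotheses give exactly what the single-cycle argument needs
proposition4p19 : (k n s : ℕ) .{{nz : NonZero n}} → 3 ≤ k → ¬ (2 ∣ k) → k < n →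
    (A : Array n) → KDiagonal n k A → HasWidth n A s → StandardForm n A →
    gcd n (s + 1) ≡ 1 → IsSolution n A (λ _ → plus) (firstNeg n)
proposition4p19 k zero s _ _ () A _ _ _ _
proposition4p19 k (suc n') s _ k-odd _ A (_ , S , size≡k , diagonals) width standard gcd≡1 =
  Walk.Cycle.single-cycle n' A (lookupℕ S) D.cells
    (D.standard-filled-0 standard) (D.gaps-coprime s width gcd≡1) (D.odd-rank k size≡k k-odd)
  where
  module D = KDiagonalArray n' A S diagonals
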